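{- Let $\Phi$ be a finite (possibly empty) sequence of types, $p_i$ a primitive type, and $\langle V,O,\mathrm{label},\mathrm{or},<,U,S\rangle$ a proof net for the sequent $\Phi\to p_i$, with root $g^0$. If $a\in V$ and $d(a)>0$, then $a<H(g^0)$.
   Context: Types are built from primitive types $p_1,p_2,\dots$ using the binary connective $\backslash$ and the unary connective $!$. A sequent has the form $\Gamma\to A$ with $\Gamma$ a finite, possibly empty, sequence of types and $A$ a type. Tree of a type. To each type $T$ associate a rooted tree $\langle V,O\rangle$ (arcs directed towards the root; $O$ is also viewed as the parent function on non-root vertices), its set of leaves $W$, a labelling $\mathrm{label}:W\to\{p_1,p_2,\dots\}$, an arc labelling $\mathrm{or}:O\to\{ -1,1,2\}$ and a strict linear order $<$ on $V$, inductively: for a primitive type $p$, a single vertex labelled $p$; for $!A$, take the structure of $A$, add a new root and an arc labelled $2$ from the root of $A$ to the new root, and order so that the new root is the least element, the rest ordered as for $A$; for $A\backslash B$, take the disjoint union of the structures for $A$ and $B$, add a new root, an arc labelled $-1$ from the root of $A$ and an arc labelled $1$ from the root of $B$ to the new root, and order $V$ as: the reversed order of the $A$-part, then the new root, then the order of the $B$-part. The structure of a sequent $A_1\dots A_n\to B$ is that of the type $A_n\backslash(A_{n-1}\backslash\cdots\backslash(A_1\backslash B)\cdots)$ (that of $B$ if $n=0$). Notation: $g^0$ is the root; $d(a)$ is the number of arcs labelled $-1$ on the path from $a$ to the root; $H(a)$ is the unique leaf from which a path to $a$ contains no arc labelled $-1$; $O^*$ is the reflexive–transitive closure of $O$; $\mathrm{pr}_1(S)=\{a\mid\exists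 b\,(a,b)\in S\}$; when $S$ is functional, $S(a)$ denotes the unique $b$ with $(a,b)\in S$. Proof net. A proof net for a sequent is its structure $\langle V,O,\mathrm{label},\mathrm{or},<\rangle$ together with a set $U\subseteq V$ and a relation $S\subseteq W\times W$ such that: PN1: $(a,b)\in S\Rightarrow(b,a)\in S$; PN2: $(a,b)\in S$ and $(a,c)\in S$ imply $b=c$; PN3: if $(a,b)\in S$, $(c,d)\in S$ and $a<c<b$, then $a<d<b$; PN4: $(a,b)\in S\Rightarrow \mathrm{label}(a)=\mathrm{label}(b)$; PN5: if $(a,b)\in S$ and $a<b$, then $d(a)=d(b)+1$; PN6: if $a\,O^*\,c$, $H(c)=b$, $a\in\mathrm{pr}_1(S)$, $S(b)$ is defined and $a<S(b)<b$, then there is $d$ with $S(a)\,O^*\,d$ and $H(d)=b$; PN7: $S\neq\emptyset$; PN8: $\mathrm{pr}_1(S)=W\cap U$; PN9: if $a\,O\,b$ and $b\notin U$, then $a\notin U$; PN10: if $a\,O\,b$, $a\notin U$ and $\mathrm{or}(a,b)\neq 2$, then $b\notin U$; PN11: if $a\,O\,b$ and $d(b)$ is even, then $\mathrm{or}(a,b)\neq 2$. -}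

module Defs where

open import Data.Nat using (ℕ; zero; suc; _+_)
open import Data.List using (List; []; _∷_; foldl)
open import Data.Product using (Σ; ∃; _×_; _,_)
open import Relation.Binary.PropositionalEquality using (_≡_; _≢_)
open import Relation.Binary.Construct.Closure.ReflexiveTransitive using (Star)
open import Relation.Nullary using (¬_)

infixr 6 _╲_

data Ty : Set where
  prim : ℕ → Ty
  _╲_  : Ty → Ty → Ty
  !_   : Ty → Ty

-- Type associated to the sequent A_1 … A_n → B :  A_n \ ( … \ (A_1 \ B))
seqTy : List Ty → Ty → Ty
seqTy Φ B = foldl (λ acc A → A ╲ acc) B Φ

-- Vertices of the tree of a type: positions (paths from the root).
data Pos : Ty → Set where
  here  : ∀ {T} → Pos T
  bang  : ∀ {A} → Pos A → Pos (! A)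
  left  : ∀ {A B} → Pos A → Pos (A ╲ B)
  right : ∀ {A B} → Pos B → Pos (A ╲ B)

sub : ∀ {T} → Pos T → Ty
sub {T} here = T
sub (bang a)  = sub a
sub (left a)  = sub a
sub (right a) = sub a

HasLabel : ∀ {T} → Pos T → ℕ → Set
HasLabel a n = sub a ≡ prim n

IsLeaf : ∀ {T} → Pos T → Set
IsLeaf a = ∃ λ n → HasLabel a n

data Or : Set where
  -1' 1' 2' : Or

-- a O b : b is the parent of a (arc from a to b), with its label
data _O_ : ∀ {T} → Pos T → Pos T → Set where
  bangRoot  : ∀ {A} → bang {A} here O here
  bangIn    : ∀ {A} {x y : Pos A} → x O y → bang x O bang y
  leftRoot  : ∀ {A B} → left {A} {B} here O here
  leftIn    : ∀ {A B} {x y : Pos A} → x O y → left {A} {B} x O left y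
  rightRoot : ∀ {A B} → right {A} {B} here O here
  rightIn   : ∀ {A B} {x y : Pos B} → x O y → right {A} {B} x O right y

or : ∀ {T} {a b : Pos T} → a O b → Or
or bangRoot    = 2'
or (bangIn p)  = or p
or leftRoot    = -1'
or (leftIn p)  = or p
or rightRoot   = 1'
or (rightIn p) = or p

data _<_ : ∀ {T} → Pos T → Pos T → Set where
  here<bang  : ∀ {A} {x : Pos A} → here < bang x
  bang<bang  : ∀ {A} {x y : Pos A} → x < y → bang x < bang y
  left<left  : ∀ {A B} {x y : Pos A} → y < x → left {A} {B} x < left y
  left<here  : ∀ {A B} {x : Pos A} → left {A} {B} x < here
  left<right : ∀ {A B} {x : Pos A} {y : Pos B} → left x < right y
  here<right : ∀ {A B} {y : Pos B} → here < right {A} {B} y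
  right<right : ∀ {A B} {x y : Pos B} → x < y → right {A} {B} x < right y

-- d(a): number of arcs labelled -1 on the path from a to the root
d : ∀ {T} → Pos T → ℕ
d here      = 0
d (bang a)  = d a
d (left a)  = suc (d a)
d (right a) = d a

data Even : ℕ → Set where
  even0  : Even 0
  even+2 : ∀ {n} → Even n → Even (suc (suc n))

-- H(a): the leaf reached from a by descending only along arcs labelled 1 or 2
headPos : (A : Ty) → Pos A
headPos (prim n) = here
headPos (A ╲ B)  = right (headPos B)
headPos (! A)    = bang (headPos A)

ext : ∀ {T} (a : Pos T) → Pos (sub a) → Pos T
ext here      x = x
ext (bang a)  x = bang (ext a x)
ext (left a)  x = left (ext a x)
ext (right a) x = right (ext a x)

H : ∀ {T} → Pos T → Pos T
H a = ext a (headPos (sub a))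

record ProofNet (T : Ty) : Set₁ where
  field
    U : Pos T → Set
    S : Pos T → Pos T → Set
    S⊆W×W : ∀ {a b : Pos T} → S a b → IsLeaf a × IsLeaf b
    PN1 : ∀ {a b : Pos T} → S a b → S b a
    PN2 : ∀ {a b c : Pos T} → S a b → S a c → b ≡ c
    PN3 : ∀ {a b c e : Pos T} → S a b → S c e → a < c → c < b → (a < e × e < b)
    PN4 : ∀ {a b : Pos T} → S a b → ∀ n → HasLabel a n → HasLabel b n
    PN5 : ∀ {a b : Pos T} → S a b → a < b → d a ≡ suc (d b)
    PN6 : ∀ {a b c : Pos T} → Star _O_ a c → H c ≡ b → (∃ λ e → S a e) →
          (∃ λ sb → S b sb × a < sb × sb < b) →
          ∀ {sa : Pos T} → S a sa → ∃ λ d' → Star _O_ sa d' × H d' ≡ b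
    PN7 : Σ (Pos T) λ a → Σ (Pos T) λ b → S a b
    PN8 : ∀ (a : Pos T) → ((∃ λ b → S a b) → IsLeaf a × U a) × (IsLeaf a × U a → ∃ λ b → S a b)
    PN9 : ∀ {a b : Pos T} → a O b → ¬ U b → ¬ U a
    PN10 : ∀ {a b : Pos T} (p : a O b) → ¬ U a → or p ≢ 2' → ¬ U b
    PN11 : ∀ {a b : Pos T} (p : a O b) → Even (d b) → or p ≢ 2'

module Submission where

open import Defs
open import Data.Nat using (ℕ; _>_)
open import Data.List using (List)

d>0⇒<headPos : ∀ {T} (a : Pos T) → d a > 0 → a < headPos T
d>0⇒<headPos {prim _} here ()
d>0⇒<headPos {_ ╲ _}  here ()
d>0⇒<headPos { ! _ } here ()
d>0⇒<headPos (left _)  _   = left<right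
d>0⇒<headPos (right b) d>0 = right<right (d>0⇒<headPos b d>0)
d>0⇒<headPos (bang b)  d>0 = bang<bang (d>0⇒<headPos b d>0)

-- The proof net is irrelevant: the claim holds in the tree of every type.
lemma2p9 : (Φ : List Ty) (i : ℕ) (N : ProofNet (seqTy Φ (prim i)))
           (a : Pos (seqTy Φ (prim i))) → d a > 0 → a < H here
lemma2p9 Φ i _ = d>0⇒<headPos
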